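{- For every typed combinatory algebra $\mathcal{T}$, the category $\mathbf{Asm}_{\mathcal{T}}$ of assemblies is a Heyting category.
   Context: A typed combinatory algebra (tca) $\mathcal{T}$ consists of a set of types containing distinguished types $\bot,\top,N$ and closed under binary operations $\times,\to,+$; for each type $T$ a set $|T|$; and total application maps $|S\to T|\times|S|\to|T|$, $(a,b)\mapsto ab$ (left associative), such that for all types $S,T,U$ there are elements $\mathsf{exf}\in|\bot\to S|$, $\mathsf{t}\in|\top|$, $\mathsf{k}\in|S\to T\to S|$, $\mathsf{s}\in|(S\to T\to U)\to(S\to T)\to(S\to U)|$, $\mathsf{pair}\in|S\to T\to S\times T|$, $\mathsf{fst}\in|S\times T\to S|$, $\mathsf{snd}\in|S\times T\to T|$, $\mathsf{inl}\in|S\to S+T|$, $\mathsf{inr}\in|T\to S+T|$, $\mathsf{case}\in|(S\to U)\to(T\to U)\to(S+T\to U)|$, $\mathsf{0}\in|N|$, $\mathsf{succ}\in|N\to N|$, $\mathsf{R}\in|S\to(N\to(S\to S))\to(N\to S)|$ satisfying $\mathsf{k}ab=a$, $\mathsf{s}abc=ac(bc)$, $\mathsf{fst}(\mathsf{pair}ab)=a$, $\mathsf{snd}(\mathsf{pair}ab)=b$, $\mathsf{case}ab(\mathsf{inl}x)=ax$, $\mathsf{case}ab(\mathsf{inr}x)=bx$, $\mathsf{R}ab\mathsf{0}=a$, $\mathsf{R}ab(\mathsf{succ}n)=bn(\mathsf{R}abn)$. An assembly over $\mathcal{T}$ is a triple $(X,A,\alpha)$ with $X$ a set, $A$ a type,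 and $\alpha$ a function assigning to each $x\in X$ an inhabited subset $\alpha(x)\subseteq|A|$. A morphism $(X,A,\alpha)\to(Y,B,\beta)$ is a function $f:X\to Y$ such that there exists $e\in|A\to B|$ with $ea\in\beta(f(x))$ whenever $a\in\alpha(x)$. $\mathbf{Asm}_{\mathcal T}$ denotes this category. -}

module Defs where

open import Level using (Level; _⊔_; 0ℓ) renaming (suc to lsuc)
open import Data.Product using (Σ; _×_; _,_; proj₁; proj₂)
open import Relation.Binary.Core using (Rel)
open import Relation.Binary.Bundles using (Setoid)
open import Relation.Binary.Structures using (IsEquivalence)
open import Relation.Binary.PropositionalEquality using (_≡_; subst; sym; trans; cong)

record TCA : Set₁ where
  infixr 5 _⇒_
  infixr 6 _⊕_
  infixr 7 _⊗_
  infixl 9 _·_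
  field
    Ty   : Set
    ⊥ᵗ   : Ty
    ⊤ᵗ   : Ty
    N    : Ty
    _⊗_  : Ty → Ty → Ty
    _⇒_  : Ty → Ty → Ty
    _⊕_  : Ty → Ty → Ty
    El   : Ty → Set
    _·_  : ∀ {S T} → El (S ⇒ T) → El S → El T
    exf  : ∀ {S} → El (⊥ᵗ ⇒ S)
    t    : El ⊤ᵗ
    k    : ∀ {S T} → El (S ⇒ T ⇒ S)
    s    : ∀ {S T U} → El ((S ⇒ T ⇒ U) ⇒ (S ⇒ T) ⇒ (S ⇒ U))
    pair : ∀ {S T} → El (S ⇒ T ⇒ S ⊗ T)
    fst  : ∀ {S T} → El (S ⊗ T ⇒ S)
    snd  : ∀ {S T} → El (S ⊗ T ⇒ T)
    inl  : ∀ {S T} → El (S ⇒ S ⊕ T)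
    inr  : ∀ {S T} → El (T ⇒ S ⊕ T)
    case : ∀ {S T U} → El ((S ⇒ U) ⇒ (T ⇒ U) ⇒ (S ⊕ T ⇒ U))
    zero : El N
    succ : El (N ⇒ N)
    R    : ∀ {S} → El (S ⇒ (N ⇒ (S ⇒ S)) ⇒ (N ⇒ S))
    k-eq    : ∀ {S T} (a : El S) (b : El T) → k · a · b ≡ a
    s-eq    : ∀ {S T U} (a : El (S ⇒ T ⇒ U)) (b : El (S ⇒ T)) (c : El S) →
              s · a · b · c ≡ a · c · (b · c)
    fst-eq  : ∀ {S T} (a : El S) (b : El T) → fst · (pair · a · b) ≡ a
    snd-eq  : ∀ {S T} (a : El S) (b : El T) → snd · (pair · a · b) ≡ b
    case-inl : ∀ {S T U} (a : El (S ⇒ U)) (b : El (T ⇒ U)) (x : El S) →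
               case · a · b · (inl · x) ≡ a · x
    case-inr : ∀ {S T U} (a : El (S ⇒ U)) (b : El (T ⇒ U)) (x : El T) →
               case · a · b · (inr · x) ≡ b · x
    R-zero  : ∀ {S} (a : El S) (b : El (N ⇒ (S ⇒ S))) → R · a · b · zero ≡ a
    R-succ  : ∀ {S} (a : El S) (b : El (N ⇒ (S ⇒ S))) (n : El N) →
              R · a · b · (succ · n) ≡ b · n · (R · a · b · n)

record Category (o ℓ e : Level) : Set (lsuc (o ⊔ ℓ ⊔ e)) where
  infix  4 _≈_
  infixr 9 _∘_
  field
    Obj  : Set o
    Hom  : Obj → Obj → Set ℓ
    _≈_  : ∀ {A B} → Rel (Hom A B) e
    id   : ∀ {A} → Hom A A
    _∘_  : ∀ {A B C} → Hom B C → Hom A B → Hom A C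
    ≈-equiv   : ∀ {A B} → IsEquivalence (_≈_ {A} {B})
    ∘-resp-≈  : ∀ {A B C} {f h : Hom B C} {g i : Hom A B} →
                f ≈ h → g ≈ i → f ∘ g ≈ h ∘ i
    identityˡ : ∀ {A B} {f : Hom A B} → id ∘ f ≈ f
    identityʳ : ∀ {A B} {f : Hom A B} → f ∘ id ≈ f
    assoc     : ∀ {A B C D} {f : Hom A B} {g : Hom B C} {h : Hom C D} →
                (h ∘ g) ∘ f ≈ h ∘ (g ∘ f)

module _ {o ℓ e : Level} (𝒞 : Category o ℓ e) where
  open Category 𝒞

  Mono : ∀ {A B} → Hom A B → Set (o ⊔ ℓ ⊔ e)
  Mono {A} f = ∀ {Z} (g h : Hom Z A) → f ∘ g ≈ f ∘ h → g ≈ h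

  IsIso : ∀ {A B} → Hom A B → Set (ℓ ⊔ e)
  IsIso {A} {B} f = Σ (Hom B A) λ g → (g ∘ f ≈ id) × (f ∘ g ≈ id)

  IsTerminal : Obj → Set (o ⊔ ℓ ⊔ e)
  IsTerminal T = ∀ X → Σ (Hom X T) λ u → ∀ (v : Hom X T) → v ≈ u

  record IsPullback {P A B C : Obj} (p₁ : Hom P A) (p₂ : Hom P B)
                    (f : Hom A C) (g : Hom B C) : Set (o ⊔ ℓ ⊔ e) where
    field
      commute   : f ∘ p₁ ≈ g ∘ p₂
      universal : ∀ {Q} (q₁ : Hom Q A) (q₂ : Hom Q B) → f ∘ q₁ ≈ g ∘ q₂ →
                  Σ (Hom Q P) λ u → (p₁ ∘ u ≈ q₁) × (p₂ ∘ u ≈ q₂)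
      unique    : ∀ {Q} (u v : Hom Q P) → p₁ ∘ u ≈ p₁ ∘ v → p₂ ∘ u ≈ p₂ ∘ v → u ≈ v

  record Pullback {A B C : Obj} (f : Hom A C) (g : Hom B C) : Set (o ⊔ ℓ ⊔ e) where
    field
      P          : Obj
      p₁         : Hom P A
      p₂         : Hom P B
      isPullback : IsPullback p₁ p₂ f g

  record FinitelyComplete : Set (o ⊔ ℓ ⊔ e) where
    field
      terminal   : Obj
      isTerminal : IsTerminal terminal
      pullback   : ∀ {A B C} (f : Hom A C) (g : Hom B C) → Pullback f g

  IsCover : ∀ {A B} → Hom A B → Set (o ⊔ ℓ ⊔ e)
  IsCover {A} {B} c = ∀ {M} (m : Hom M B) (g : Hom A M) → Mono m → m ∘ g ≈ c → IsIso m

  -- Regular category (Johnstone, Elephant A1.3.3): cartesian, every morphism factors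
  -- as a cover followed by a mono, covers are stable under pullback.
  record IsRegular : Set (lsuc (o ⊔ ℓ ⊔ e)) where
    field
      finitelyComplete : FinitelyComplete
      factorise : ∀ {A B} (f : Hom A B) →
                  Σ Obj λ M → Σ (Hom A M) λ c → Σ (Hom M B) λ m →
                    IsCover c × Mono m × (m ∘ c ≈ f)
      cover-stable : ∀ {A B C} (c : Hom A C) (g : Hom B C) → IsCover c →
                     (pb : Pullback c g) → IsCover (Pullback.p₂ pb)

  record Sub (X : Obj) : Set (o ⊔ ℓ ⊔ e) where
    field
      dom  : Obj
      arr  : Hom dom X
      mono : Mono arr

  _≤ˢ_ : ∀ {X} → Sub X → Sub X → Set (ℓ ⊔ e)
  m ≤ˢ n = Σ (Hom (Sub.dom m) (Sub.dom n)) λ h → Sub.arr n ∘ h ≈ Sub.arr m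

  IsJoin : ∀ {X} → Sub X → Sub X → Sub X → Set (o ⊔ ℓ ⊔ e)
  IsJoin {X} m n j = (m ≤ˢ j) × (n ≤ˢ j) × (∀ (u : Sub X) → m ≤ˢ u → n ≤ˢ u → j ≤ˢ u)

  IsLeast : ∀ {X} → Sub X → Set (o ⊔ ℓ ⊔ e)
  IsLeast {X} b = ∀ (u : Sub X) → b ≤ˢ u

  private
    module E {A B} = IsEquivalence (≈-equiv {A} {B})

  pullback-mono : ∀ {P A B C} {p₁ : Hom P A} {p₂ : Hom P B} {n : Hom A C} {f : Hom B C} →
                  IsPullback p₁ p₂ n f → Mono n → Mono p₂
  pullback-mono {p₁ = p₁} {p₂} {n} {f} pb mn g h eq =
    IsPullback.unique pb g h (mn (p₁ ∘ g) (p₁ ∘ h) step) eq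
    where
    open IsPullback pb
    step : n ∘ (p₁ ∘ g) ≈ n ∘ (p₁ ∘ h)
    step = E.trans (E.sym assoc)
           (E.trans (∘-resp-≈ commute E.refl)
           (E.trans assoc
           (E.trans (∘-resp-≈ E.refl eq)
           (E.trans (E.sym assoc)
           (E.trans (∘-resp-≈ (E.sym commute) E.refl) assoc)))))

  pullbackSub : FinitelyComplete → ∀ {A B} (f : Hom A B) → Sub B → Sub A
  pullbackSub fc f n = record
    { dom  = Pullback.P pb
    ; arr  = Pullback.p₂ pb
    ; mono = pullback-mono (Pullback.isPullback pb) (Sub.mono n) }
    where pb = FinitelyComplete.pullback fc (Sub.arr n) f

  -- Coherent category (Elephant A1.4.1): regular, each Sub(X) has finite unions
  -- (binary joins and a least element), stable under pullback.
  record IsCoherentOver (reg : IsRegular) : Set (lsuc (o ⊔ ℓ ⊔ e)) where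
    private f* = pullbackSub (IsRegular.finitelyComplete reg)
    field
      join        : ∀ {X} (m n : Sub X) → Σ (Sub X) (IsJoin m n)
      bottom      : ∀ X → Σ (Sub X) IsLeast
      join-stable : ∀ {A B} (f : Hom A B) (m n j : Sub B) →
                    IsJoin m n j → IsJoin (f* f m) (f* f n) (f* f j)
      bottom-stable : ∀ {A B} (f : Hom A B) (b : Sub B) →
                      IsLeast b → IsLeast (f* f b)

  -- Heyting: moreover every f* : Sub(B) → Sub(A) has a right adjoint ∀_f.
  record HasUniversalsOver (reg : IsRegular) : Set (lsuc (o ⊔ ℓ ⊔ e)) where
    private f* = pullbackSub (IsRegular.finitelyComplete reg)
    field
      ∀[_]   : ∀ {A B} (f : Hom A B) → Sub A → Sub B
      ∀-adj  : ∀ {A B} (f : Hom A B) (m : Sub A) (n : Sub B) →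
               (f* f n ≤ˢ m → n ≤ˢ ∀[ f ] m) × (n ≤ˢ ∀[ f ] m → f* f n ≤ˢ m)

  record IsHeyting : Set (lsuc (o ⊔ ℓ ⊔ e)) where
    field
      regular    : IsRegular
      coherent   : IsCoherentOver regular
      universals : HasUniversalsOver regular

-- Assemblies over a tca.  Sets are modelled as setoids; α must respect
-- the equality of the underlying set.

module _ (𝒯 : TCA) where
  open TCA 𝒯

  record Assembly : Set₁ where
    field
      X     : Setoid 0ℓ 0ℓ
      A     : Ty
      α     : Setoid.Carrier X → El A → Set
      α-inh : ∀ x → Σ (El A) (α x)
      α-resp : ∀ {x y} → Setoid._≈_ X x y → ∀ a → α x a → α y a

  record AsmHom (𝕏 𝕐 : Assembly) : Set where
    private
      module X = Assembly 𝕏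
      module Y = Assembly 𝕐
      module SX = Setoid X.X
      module SY = Setoid Y.X
    field
      fun     : SX.Carrier → SY.Carrier
      fun-resp : ∀ {x y} → x SX.≈ y → fun x SY.≈ fun y
      tracker : El (X.A ⇒ Y.A)
      tracks  : ∀ x a → X.α x a → Y.α (fun x) (tracker · a)

  private
    I : ∀ {A} → El (A ⇒ A)
    I {A} = s {A} {A ⇒ A} {A} · k · k

    I-eq : ∀ {A} (a : El A) → I · a ≡ a
    I-eq a = trans (s-eq k k a) (k-eq a (k · a))

    Bc : ∀ {A B C} → El (B ⇒ C) → El (A ⇒ B) → El (A ⇒ C)
    Bc g f = s · (k · g) · f

    B-eq : ∀ {A B C} (g : El (B ⇒ C)) (f : El (A ⇒ B)) (a : El A) → Bc g f · a ≡ g · (f · a)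
    B-eq g f a = trans (s-eq (k · g) f a) (cong (_· (f · a)) (k-eq g a))

  Asm : Category (lsuc 0ℓ) 0ℓ 0ℓ
  Asm = record
    { Obj = Assembly
    ; Hom = AsmHom
    ; _≈_ = λ {𝕏} {𝕐} f g → ∀ x → Setoid._≈_ (Assembly.X 𝕐) (AsmHom.fun f x) (AsmHom.fun g x)
    ; id = λ {𝕏} → record
        { fun = λ x → x ; fun-resp = λ p → p ; tracker = I
        ; tracks = λ x a r → subst (Assembly.α 𝕏 x) (sym (I-eq a)) r }
    ; _∘_ = λ {𝕏} {𝕐} {ℤ} g f → record
        { fun = λ x → AsmHom.fun g (AsmHom.fun f x)
        ; fun-resp = λ p → AsmHom.fun-resp g (AsmHom.fun-resp f p)
        ; tracker = Bc (AsmHom.tracker g) (AsmHom.tracker f)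
        ; tracks = λ x a r → subst (Assembly.α ℤ (AsmHom.fun g (AsmHom.fun f x)))
                     (sym (B-eq (AsmHom.tracker g) (AsmHom.tracker f) a))
                     (AsmHom.tracks g _ _ (AsmHom.tracks f x a r)) }
    ; ≈-equiv = λ {𝕏} {𝕐} → record
        { refl  = λ x → Setoid.refl (Assembly.X 𝕐)
        ; sym   = λ p x → Setoid.sym (Assembly.X 𝕐) (p x)
        ; trans = λ p q x → Setoid.trans (Assembly.X 𝕐) (p x) (q x) }
    ; ∘-resp-≈ = λ {𝕏} {𝕐} {ℤ} {f} {h} {g} {i} p q x →
        Setoid.trans (Assembly.X ℤ) (AsmHom.fun-resp f (q x)) (p (AsmHom.fun i x))
    ; identityˡ = λ {𝕏} {𝕐} x → Setoid.refl (Assembly.X 𝕐)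
    ; identityʳ = λ {𝕏} {𝕐} x → Setoid.refl (Assembly.X 𝕐)
    ; assoc = λ {𝕏} {𝕐} {ℤ} {𝕎} x → Setoid.refl (Assembly.X 𝕎)
    }

{-# OPTIONS --safe #-}
-- Monos of assemblies are the injective morphisms, and covers are the surjections with a
-- realizer sending realizers of a point to realizers of some preimage. Images and pullbacks
-- are computed on underlying sets, with realizers assembled from k, s, pair, fst and snd,
-- and a preimage realizer for a cover pulls back along the canonical pullback. The union of
-- two subobjects is the image of their copairing, realized by 'case'. The universal
-- quantification ∀_f M consists of those b all of whose f-preimages lie in M, realized by
-- a realizer of b paired with a function that turns realizers of any preimage a into
-- realizers of a in M. Stability of unions and of the empty subobject under pullback then
-- holds in any category, because f* has the right adjoint ∀_f.
module Submission where

open import Defs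
open import Level using (Level; _⊔_; 0ℓ)
open import Data.Empty using (⊥-elim) renaming (⊥ to Empty)
open import Data.Product using (Σ; _×_; _,_; proj₁; proj₂)
open import Data.Product.Relation.Binary.Pointwise.NonDependent using (×-setoid)
open import Data.Sum using (_⊎_; inj₁; inj₂; [_,_])
open import Data.Sum.Relation.Binary.Pointwise using (⊎-setoid; inj₁; inj₂)
open import Data.Unit using (⊤; tt)
open import Relation.Binary.Bundles using (Setoid)
open import Relation.Binary.Structures using (IsEquivalence)
import Relation.Binary.Construct.Always as Always
import Relation.Binary.Construct.On as On
open import Relation.Binary.PropositionalEquality using (_≡_; refl; subst; sym; trans; cong; module ≡-Reasoning)

module SubobjectOrder {o ℓ e : Level} (𝒞 : Category o ℓ e) where
  open Category 𝒞
  private module ≈ {A B} = IsEquivalence (≈-equiv {A} {B})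

  _≤_ : ∀ {X} → Sub 𝒞 X → Sub 𝒞 X → Set (ℓ ⊔ e)
  _≤_ = _≤ˢ_ 𝒞

  ≤-refl : ∀ {X} (m : Sub 𝒞 X) → m ≤ m
  ≤-refl m = id , identityʳ

  ≤-trans : ∀ {X} {m n u : Sub 𝒞 X} → m ≤ n → n ≤ u → m ≤ u
  ≤-trans (h , c) (h′ , c′) = h′ ∘ h , ≈.trans (≈.sym assoc) (≈.trans (∘-resp-≈ c′ ≈.refl) c)

  module _ (reg : IsRegular 𝒞) (univ : HasUniversalsOver 𝒞 reg) where
    open HasUniversalsOver univ

    private
      _* : ∀ {A B} → Hom A B → Sub 𝒞 B → Sub 𝒞 A
      _* = pullbackSub 𝒞 (IsRegular.finitelyComplete reg)

      unit : ∀ {A B} (f : Hom A B) (n : Sub 𝒞 B) (m : Sub 𝒞 A) → (f *) n ≤ m → n ≤ ∀[ f ] m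
      unit f n m = proj₁ (∀-adj f m n)

      counit : ∀ {A B} (f : Hom A B) (n : Sub 𝒞 B) (m : Sub 𝒞 A) → n ≤ ∀[ f ] m → (f *) n ≤ m
      counit f n m = proj₂ (∀-adj f m n)

    pullbackSub-mono : ∀ {A B} (f : Hom A B) (m n : Sub 𝒞 B) → m ≤ n → (f *) m ≤ (f *) n
    pullbackSub-mono f m n m≤n =
      counit f m ((f *) n) (≤-trans {m = m} {n} {∀[ f ] ((f *) n)} m≤n (unit f n ((f *) n) (≤-refl ((f *) n))))

    pullbackSub-preserves-join : ∀ {A B} (f : Hom A B) (m n j : Sub 𝒞 B) →
                                 IsJoin 𝒞 m n j → IsJoin 𝒞 ((f *) m) ((f *) n) ((f *) j)
    pullbackSub-preserves-join f m n j (m≤j , n≤j , least) =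
        pullbackSub-mono f m j m≤j
      , pullbackSub-mono f n j n≤j
      , λ u m≤u n≤u → counit f j u (least (∀[ f ] u) (unit f m u m≤u) (unit f n u n≤u))

    pullbackSub-preserves-least : ∀ {A B} (f : Hom A B) (b : Sub 𝒞 B) →
                                  IsLeast 𝒞 b → IsLeast 𝒞 ((f *) b)
    pullbackSub-preserves-least f b least u = counit f b u (least (∀[ f ] u))

    coherent-from-universals : (∀ {X} (m n : Sub 𝒞 X) → Σ (Sub 𝒞 X) (IsJoin 𝒞 m n)) →
                               (∀ X → Σ (Sub 𝒞 X) (IsLeast 𝒞)) → IsCoherentOver 𝒞 reg
    coherent-from-universals join bottom = record
      { join          = join
      ; bottom        = bottom
      ; join-stable   = pullbackSub-preserves-join
      ; bottom-stable = pullbackSub-preserves-least }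

module Combinators (𝒯 : TCA) where
  open TCA 𝒯

  I : ∀ {S} → El (S ⇒ S)
  I {S} = s {S} {S ⇒ S} {S} · k · k

  I-eq : ∀ {S} (a : El S) → I · a ≡ a
  I-eq a = trans (s-eq k k a) (k-eq a (k · a))

  B : ∀ {S T U} → El (T ⇒ U) → El (S ⇒ T) → El (S ⇒ U)
  B g f = s · (k · g) · f

  B-eq : ∀ {S T U} (g : El (T ⇒ U)) (f : El (S ⇒ T)) (a : El S) → B g f · a ≡ g · (f · a)
  B-eq g f a = trans (s-eq (k · g) f a) (cong (_· (f · a)) (k-eq g a))

  ⟨_,_⟩ : ∀ {S T U} → El (S ⇒ T) → El (S ⇒ U) → El (S ⇒ T ⊗ U)
  ⟨ f , g ⟩ = s · (B pair f) · g

  ⟨,⟩-eq : ∀ {S T U} (f : El (S ⇒ T)) (g : El (S ⇒ U)) (a : El S) →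
           ⟨ f , g ⟩ · a ≡ pair · (f · a) · (g · a)
  ⟨,⟩-eq f g a = trans (s-eq (B pair f) g a) (cong (_· (g · a)) (B-eq pair f a))

  fst-⟨,⟩ : ∀ {S T U} (f : El (S ⇒ T)) (g : El (S ⇒ U)) (a : El S) → fst · (⟨ f , g ⟩ · a) ≡ f · a
  fst-⟨,⟩ f g a = trans (cong (fst ·_) (⟨,⟩-eq f g a)) (fst-eq _ _)

  snd-⟨,⟩ : ∀ {S T U} (f : El (S ⇒ T)) (g : El (S ⇒ U)) (a : El S) → snd · (⟨ f , g ⟩ · a) ≡ g · a
  snd-⟨,⟩ f g a = trans (cong (snd ·_) (⟨,⟩-eq f g a)) (snd-eq _ _)

  Λ : ∀ {S T U} → El (S ⊗ T ⇒ U) → El (S ⇒ T ⇒ U)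
  Λ h = B (s · (k · h)) pair

  Λ-eq : ∀ {S T U} (h : El (S ⊗ T ⇒ U)) (a : El S) (b : El T) → Λ h · a · b ≡ h · (pair · a · b)
  Λ-eq h a b = begin
      Λ h · a · b                        ≡⟨ cong (_· b) (B-eq _ pair a) ⟩
      s · (k · h) · (pair · a) · b       ≡⟨ s-eq _ _ b ⟩
      k · h · b · (pair · a · b)         ≡⟨ cong (_· (pair · a · b)) (k-eq h b) ⟩
      h · (pair · a · b)                 ∎
    where open ≡-Reasoning

module Assemblies (𝒯 : TCA) where
  open TCA 𝒯
  open Combinators 𝒯
  open Category (Asm 𝒯)
  open AsmHom
  open SubobjectOrder (Asm 𝒯) using (_≤_)

  Car : Assembly 𝒯 → Set
  Car 𝕏 = Setoid.Carrier (Assembly.X 𝕏)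

  A : Assembly 𝒯 → Ty
  A = Assembly.A

  α : (𝕏 : Assembly 𝒯) → Car 𝕏 → El (A 𝕏) → Set
  α = Assembly.α

  _∋_≃_ : (𝕏 : Assembly 𝒯) → Car 𝕏 → Car 𝕏 → Set
  𝕏 ∋ x ≃ y = Setoid._≈_ (Assembly.X 𝕏) x y

  ≃-refl : ∀ 𝕏 {x} → 𝕏 ∋ x ≃ x
  ≃-refl 𝕏 = Setoid.refl (Assembly.X 𝕏)

  ≃-sym : ∀ 𝕏 {x y} → 𝕏 ∋ x ≃ y → 𝕏 ∋ y ≃ x
  ≃-sym 𝕏 = Setoid.sym (Assembly.X 𝕏)

  ≃-trans : ∀ 𝕏 {x y z} → 𝕏 ∋ x ≃ y → 𝕏 ∋ y ≃ z → 𝕏 ∋ x ≃ z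
  ≃-trans 𝕏 = Setoid.trans (Assembly.X 𝕏)

  realizer : (𝕏 : Assembly 𝒯) → Car 𝕏 → El (A 𝕏)
  realizer 𝕏 x = proj₁ (Assembly.α-inh 𝕏 x)

  realizer-α : (𝕏 : Assembly 𝒯) (x : Car 𝕏) → α 𝕏 x (realizer 𝕏 x)
  realizer-α 𝕏 x = proj₂ (Assembly.α-inh 𝕏 x)

  α-resp : (𝕏 : Assembly 𝒯) {x y : Car 𝕏} → 𝕏 ∋ x ≃ y → ∀ {a} → α 𝕏 x a → α 𝕏 y a
  α-resp 𝕏 x≃y {a} = Assembly.α-resp 𝕏 x≃y a

  α-≡ : (𝕏 : Assembly 𝒯) {x : Car 𝕏} {a b : El (A 𝕏)} → a ≡ b → α 𝕏 x b → α 𝕏 x a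
  α-≡ 𝕏 {x} a≡b = subst (α 𝕏 x) (sym a≡b)

  -- Monos and points

  𝟙 : Assembly 𝒯
  𝟙 = record
    { X = Always.setoid ⊤ 0ℓ ; A = ⊤ᵗ ; α = λ _ _ → ⊤
    ; α-inh = λ _ → t , tt ; α-resp = λ _ _ _ → tt }

  𝟙-terminal : IsTerminal (Asm 𝒯) 𝟙
  𝟙-terminal 𝕏 = record { fun = λ _ → tt ; fun-resp = λ _ → _ ; tracker = k · t ; tracks = λ _ _ _ → tt }
               , λ _ _ → _

  point : (𝕏 : Assembly 𝒯) → Car 𝕏 → Hom 𝟙 𝕏
  point 𝕏 x = record
    { fun = λ _ → x ; fun-resp = λ _ → ≃-refl 𝕏 ; tracker = k · realizer 𝕏 x
    ; tracks = λ _ a _ → α-≡ 𝕏 (k-eq _ a) (realizer-α 𝕏 x) }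

  Injective : ∀ {𝕏 𝕐} → Hom 𝕏 𝕐 → Set
  Injective {𝕏} {𝕐} f = ∀ {x y} → 𝕐 ∋ fun f x ≃ fun f y → 𝕏 ∋ x ≃ y

  mono⇒injective : ∀ {𝕏 𝕐} (f : Hom 𝕏 𝕐) → Mono (Asm 𝒯) f → Injective f
  mono⇒injective {𝕏} f mono {x} {y} fx≃fy = mono (point 𝕏 x) (point 𝕏 y) (λ _ → fx≃fy) tt

  injective⇒mono : ∀ {𝕏 𝕐} (f : Hom 𝕏 𝕐) → Injective f → Mono (Asm 𝒯) f
  injective⇒mono f inj _ _ fg≈fh z = inj (fg≈fh z)

  Sub-injective : ∀ {𝕏} (m : Sub (Asm 𝒯) 𝕏) → Injective (Sub.arr m)
  Sub-injective m = mono⇒injective (Sub.arr m) (Sub.mono m)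

  -- Finite limits

  module CanonicalPullback {𝔸 𝔹 ℂ : Assembly 𝒯} (f : Hom 𝔸 ℂ) (g : Hom 𝔹 ℂ) where
    Carrier : Set
    Carrier = Σ (Car 𝔸) λ a → Σ (Car 𝔹) λ b → ℂ ∋ fun f a ≃ fun g b

    ends : Carrier → Car 𝔸 × Car 𝔹
    ends (a , b , _) = a , b

    obj : Assembly 𝒯
    obj = record
      { X = On.setoid (×-setoid (Assembly.X 𝔸) (Assembly.X 𝔹)) ends
      ; A = A 𝔸 ⊗ A 𝔹
      ; α = λ (a , b , _) r → α 𝔸 a (fst · r) × α 𝔹 b (snd · r)
      ; α-inh = λ (a , b , _) → pair · realizer 𝔸 a · realizer 𝔹 b
                              , α-≡ 𝔸 (fst-eq _ _) (realizer-α 𝔸 a)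
                              , α-≡ 𝔹 (snd-eq _ _) (realizer-α 𝔹 b)
      ; α-resp = λ (a≃ , b≃) _ (ra , rb) → α-resp 𝔸 a≃ ra , α-resp 𝔹 b≃ rb }

    π₁ : Hom obj 𝔸
    π₁ = record { fun = proj₁ ; fun-resp = proj₁ ; tracker = fst ; tracks = λ _ _ → proj₁ }

    π₂ : Hom obj 𝔹
    π₂ = record { fun = λ p → proj₁ (proj₂ p) ; fun-resp = proj₂ ; tracker = snd ; tracks = λ _ _ → proj₂ }

    isPullback : IsPullback (Asm 𝒯) π₁ π₂ f g
    isPullback = record
      { commute   = λ p → proj₂ (proj₂ p)
      ; universal = λ q₁ q₂ q-commute →
          record { fun      = λ z → fun q₁ z , fun q₂ z , q-commute z
                 ; fun-resp = λ z≃ → fun-resp q₁ z≃ , fun-resp q₂ z≃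
                 ; tracker  = ⟨ tracker q₁ , tracker q₂ ⟩
                 ; tracks   = λ z r rz → α-≡ 𝔸 (fst-⟨,⟩ _ _ r) (tracks q₁ z r rz)
                                       , α-≡ 𝔹 (snd-⟨,⟩ _ _ r) (tracks q₂ z r rz) }
          , (λ _ → ≃-refl 𝔸) , (λ _ → ≃-refl 𝔹)
      ; unique    = λ _ _ π₁≈ π₂≈ z → π₁≈ z , π₂≈ z }

    pullback : Pullback (Asm 𝒯) f g
    pullback = record { P = obj ; p₁ = π₁ ; p₂ = π₂ ; isPullback = isPullback }

  finitelyComplete : FinitelyComplete (Asm 𝒯)
  finitelyComplete = record
    { terminal = 𝟙 ; isTerminal = 𝟙-terminal ; pullback = CanonicalPullback.pullback }

  -- Covers and images

  RealizedSurjective : ∀ {𝔸 𝔹} → Hom 𝔸 𝔹 → Set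
  RealizedSurjective {𝔸} {𝔹} c =
    Σ (El (A 𝔹 ⇒ A 𝔸)) λ e → ∀ y b → α 𝔹 y b → Σ (Car 𝔸) λ x → (𝔹 ∋ fun c x ≃ y) × α 𝔸 x (e · b)

  realizedSurjective⇒cover : ∀ {𝔸 𝔹} (c : Hom 𝔸 𝔹) → RealizedSurjective c → IsCover (Asm 𝒯) c
  realizedSurjective⇒cover {𝔸} {𝔹} c (e , surj) {𝕄} m g m-mono mg≈c = section , section∘m≈id , m∘section≈id
    where
    inj = mono⇒injective m m-mono

    preimage : Car 𝔹 → Car 𝔸
    preimage y = proj₁ (surj y (realizer 𝔹 y) (realizer-α 𝔹 y))

    m∘g∘preimage : ∀ y → 𝔹 ∋ fun m (fun g (preimage y)) ≃ y
    m∘g∘preimage y = ≃-trans 𝔹 (mg≈c (preimage y)) (proj₁ (proj₂ (surj y _ (realizer-α 𝔹 y))))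

    section : Hom 𝔹 𝕄
    section = record
      { fun      = λ y → fun g (preimage y)
      ; fun-resp = λ {y} {y′} y≃y′ →
          inj (≃-trans 𝔹 (m∘g∘preimage y) (≃-trans 𝔹 y≃y′ (≃-sym 𝔹 (m∘g∘preimage y′))))
      ; tracker  = B (tracker g) e
      ; tracks   = λ y b rb →
          let (x , cx≃y , rx) = surj y b rb
          in α-≡ 𝕄 (B-eq _ _ b)
               (α-resp 𝕄 (inj (≃-trans 𝔹 (mg≈c x) (≃-trans 𝔹 cx≃y (≃-sym 𝔹 (m∘g∘preimage y)))))
                 (tracks g x (e · b) rx)) }

    section∘m≈id : section ∘ m ≈ id
    section∘m≈id z = inj (m∘g∘preimage (fun m z))

    m∘section≈id : m ∘ section ≈ id
    m∘section≈id = m∘g∘preimage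

  module Image {𝔸 𝔹 : Assembly 𝒯} (f : Hom 𝔸 𝔹) where
    -- α must respect the coarser equality, so x is realized by the realizers of every x′ with f x′ ≃ f x.
    obj : Assembly 𝒯
    obj = record
      { X = On.setoid (Assembly.X 𝔹) (fun f)
      ; A = A 𝔸
      ; α = λ x r → Σ (Car 𝔸) λ x′ → (𝔹 ∋ fun f x′ ≃ fun f x) × α 𝔸 x′ r
      ; α-inh = λ x → realizer 𝔸 x , x , ≃-refl 𝔹 , realizer-α 𝔸 x
      ; α-resp = λ fx≃fy _ (x′ , fx′≃fx , rx′) → x′ , ≃-trans 𝔹 fx′≃fx fx≃fy , rx′ }

    cover : Hom 𝔸 obj
    cover = record
      { fun = λ x → x ; fun-resp = fun-resp f ; tracker = I
      ; tracks = λ x a ra → x , ≃-refl 𝔹 , α-≡ 𝔸 (I-eq a) ra }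

    incl : Hom obj 𝔹
    incl = record
      { fun = fun f ; fun-resp = λ fx≃fy → fx≃fy ; tracker = tracker f
      ; tracks = λ x a (x′ , fx′≃fx , rx′) → α-resp 𝔹 fx′≃fx (tracks f x′ a rx′) }

    incl-mono : Mono (Asm 𝒯) incl
    incl-mono = injective⇒mono incl (λ fx≃fy → fx≃fy)

    cover-isCover : IsCover (Asm 𝒯) cover
    cover-isCover = realizedSurjective⇒cover cover
      (I , λ x b (x′ , fx′≃fx , rx′) → x′ , fx′≃fx , α-≡ 𝔸 (I-eq b) rx′)

    sub : Sub (Asm 𝒯) 𝔹
    sub = record { dom = obj ; arr = incl ; mono = incl-mono }

    least : (u : Sub (Asm 𝒯) 𝔹) (g : Hom 𝔸 (Sub.dom u)) → Sub.arr u ∘ g ≈ f → sub ≤ u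
    least u g ug≈f = g′ , ug≈f
      where
      𝕌 = Sub.dom u
      inj = Sub-injective u

      g-resp : ∀ {x y} → 𝔹 ∋ fun f x ≃ fun f y → 𝕌 ∋ fun g x ≃ fun g y
      g-resp fx≃fy = inj (≃-trans 𝔹 (ug≈f _) (≃-trans 𝔹 fx≃fy (≃-sym 𝔹 (ug≈f _))))

      g′ : Hom obj 𝕌
      g′ = record
        { fun = fun g ; fun-resp = g-resp ; tracker = tracker g
        ; tracks = λ x a (x′ , fx′≃fx , rx′) → α-resp 𝕌 (g-resp fx′≃fx) (tracks g x′ a rx′) }

  cover⇒realizedSurjective : ∀ {𝔸 𝔹} (c : Hom 𝔸 𝔹) → IsCover (Asm 𝒯) c → RealizedSurjective c
  cover⇒realizedSurjective {𝔸} {𝔹} c c-cover = tracker h , λ y b rb →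
      let (x , cx≃chy , rx) = tracks h y b rb in x , ≃-trans 𝔹 cx≃chy (incl∘h≈id y) , rx
    where
    open Image c
    h-iso = c-cover incl cover incl-mono (λ _ → ≃-refl 𝔹)
    h = proj₁ h-iso
    incl∘h≈id = proj₂ (proj₂ h-iso)

  realizedSurjective-factor : ∀ {𝔸 𝔹 ℂ} (q : Hom 𝔸 ℂ) (u : Hom 𝔹 𝔸) (r : Hom 𝔹 ℂ) →
                              q ∘ u ≈ r → RealizedSurjective r → RealizedSurjective q
  realizedSurjective-factor {𝔸} {𝔹} {ℂ} q u r qu≈r (e , surj) = B (tracker u) e , λ y b rb →
    let (x , rx≃y , rx) = surj y b rb
    in fun u x , ≃-trans ℂ (qu≈r x) rx≃y , α-≡ 𝔸 (B-eq _ _ b) (tracks u x (e · b) rx)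

  canonicalPullback-realizedSurjective : ∀ {𝔸 𝔹 ℂ} (c : Hom 𝔸 ℂ) (g : Hom 𝔹 ℂ) →
    RealizedSurjective c → RealizedSurjective (CanonicalPullback.π₂ c g)
  canonicalPullback-realizedSurjective {𝔸} {𝔹} c g (e , surj) = ⟨ B e (tracker g) , I ⟩ , λ y b rb →
    let (x , cx≃gy , rx) = surj (fun g y) (tracker g · b) (tracks g y b rb)
    in (x , y , cx≃gy) , ≃-refl 𝔹
     , α-≡ 𝔸 (trans (fst-⟨,⟩ _ _ b) (B-eq _ _ b)) rx
     , α-≡ 𝔹 (trans (snd-⟨,⟩ _ _ b) (I-eq b)) rb

  cover-stable : ∀ {𝔸 𝔹 ℂ} (c : Hom 𝔸 ℂ) (g : Hom 𝔹 ℂ) → IsCover (Asm 𝒯) c →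
                 (pb : Pullback (Asm 𝒯) c g) → IsCover (Asm 𝒯) (Pullback.p₂ pb)
  cover-stable c g c-cover pb =
    realizedSurjective⇒cover p₂
      (realizedSurjective-factor p₂ (proj₁ comparison) π₂ (proj₂ (proj₂ comparison))
        (canonicalPullback-realizedSurjective c g (cover⇒realizedSurjective c c-cover)))
    where
    open Pullback pb
    open CanonicalPullback c g using (π₁; π₂)
    comparison = IsPullback.universal isPullback π₁ π₂ (IsPullback.commute (CanonicalPullback.isPullback c g))

  regular : IsRegular (Asm 𝒯)
  regular = record
    { finitelyComplete = finitelyComplete
    ; factorise = λ {_} {𝔹} f →
        Image.obj f , Image.cover f , Image.incl f , Image.cover-isCover f , Image.incl-mono f , λ _ → ≃-refl 𝔹
    ; cover-stable = cover-stable }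

  -- Unions and the empty subobject

  _⊎ᴬ_ : Assembly 𝒯 → Assembly 𝒯 → Assembly 𝒯
  𝕌 ⊎ᴬ 𝕍 = record
    { X = ⊎-setoid (Assembly.X 𝕌) (Assembly.X 𝕍)
    ; A = A 𝕌 ⊕ A 𝕍
    ; α = α⊎
    ; α-inh = λ { (inj₁ x) → inl · realizer 𝕌 x , _ , refl , realizer-α 𝕌 x
                ; (inj₂ y) → inr · realizer 𝕍 y , _ , refl , realizer-α 𝕍 y }
    ; α-resp = λ { (inj₁ x≃) _ (a , r≡ , ra) → a , r≡ , α-resp 𝕌 x≃ ra
                 ; (inj₂ y≃) _ (b , r≡ , rb) → b , r≡ , α-resp 𝕍 y≃ rb } }
    where
    α⊎ : Car 𝕌 ⊎ Car 𝕍 → El (A 𝕌 ⊕ A 𝕍) → Set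
    α⊎ (inj₁ x) r = Σ (El (A 𝕌)) λ a → (r ≡ inl · a) × α 𝕌 x a
    α⊎ (inj₂ y) r = Σ (El (A 𝕍)) λ b → (r ≡ inr · b) × α 𝕍 y b

  ι₁ : ∀ {𝕌 𝕍} → Hom 𝕌 (𝕌 ⊎ᴬ 𝕍)
  ι₁ = record { fun = inj₁ ; fun-resp = inj₁ ; tracker = inl ; tracks = λ _ a ra → a , refl , ra }

  ι₂ : ∀ {𝕌 𝕍} → Hom 𝕍 (𝕌 ⊎ᴬ 𝕍)
  ι₂ = record { fun = inj₂ ; fun-resp = inj₂ ; tracker = inr ; tracks = λ _ b rb → b , refl , rb }

  [_,_]ᴬ : ∀ {𝕌 𝕍 ℤ} → Hom 𝕌 ℤ → Hom 𝕍 ℤ → Hom (𝕌 ⊎ᴬ 𝕍) ℤ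
  [_,_]ᴬ {ℤ = ℤ} g h = record
    { fun      = [ fun g , fun h ]
    ; fun-resp = λ { (inj₁ x≃) → fun-resp g x≃ ; (inj₂ y≃) → fun-resp h y≃ }
    ; tracker  = case · tracker g · tracker h
    ; tracks   = λ { (inj₁ x) _ (a , refl , ra) → α-≡ ℤ (case-inl _ _ a) (tracks g x a ra)
                   ; (inj₂ y) _ (b , refl , rb) → α-≡ ℤ (case-inr _ _ b) (tracks h y b rb) } }

  join : ∀ {𝕏} (m n : Sub (Asm 𝒯) 𝕏) → Σ (Sub (Asm 𝒯) 𝕏) (IsJoin (Asm 𝒯) m n)
  join {𝕏} m n = sub , (cover ∘ ι₁ , λ _ → ≃-refl 𝕏) , (cover ∘ ι₂ , λ _ → ≃-refl 𝕏) , least′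
    where
    open Image [ Sub.arr m , Sub.arr n ]ᴬ

    least′ : ∀ u → m ≤ u → n ≤ u → sub ≤ u
    least′ u (g , ug≈m) (h , uh≈n) = least u [ g , h ]ᴬ λ { (inj₁ x) → ug≈m x ; (inj₂ y) → uh≈n y }

  𝟘 : Assembly 𝒯
  𝟘 = record
    { X = Always.setoid Empty 0ℓ ; A = ⊥ᵗ ; α = λ () ; α-inh = λ () ; α-resp = λ {x} → ⊥-elim x }

  ¡ : (𝕐 : Assembly 𝒯) → Hom 𝟘 𝕐
  ¡ 𝕐 = record { fun = λ () ; fun-resp = λ {x} → ⊥-elim x ; tracker = exf ; tracks = λ () }

  bottom : ∀ 𝕏 → Σ (Sub (Asm 𝒯) 𝕏) (IsLeast (Asm 𝒯))
  bottom 𝕏 = record { dom = 𝟘 ; arr = ¡ 𝕏 ; mono = λ g _ _ z → ⊥-elim (fun g z) }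
           , λ u → ¡ (Sub.dom u) , λ ()

  -- Universal quantification

  module Forall {𝔸 𝔹 : Assembly 𝒯} (f : Hom 𝔸 𝔹) (m : Sub (Asm 𝒯) 𝔸) where
    private
      𝕄 = Sub.dom m
      _* = pullbackSub (Asm 𝒯) finitelyComplete

    Witnesses : Car 𝔹 → El (A 𝔸 ⇒ A 𝕄) → Set
    Witnesses b φ = ∀ a ra → 𝔹 ∋ fun f a ≃ b → α 𝔸 a ra →
                    Σ (Car 𝕄) λ x → (𝔸 ∋ fun (Sub.arr m) x ≃ a) × α 𝕄 x (φ · ra)

    -- The witnessing realizer φ is part of the point, but equality only sees b.
    Carrier : Set
    Carrier = Σ (Car 𝔹) λ b → Σ (El (A 𝔸 ⇒ A 𝕄)) (Witnesses b)

    base : Carrier → Car 𝔹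
    base = proj₁

    obj : Assembly 𝒯
    obj = record
      { X = On.setoid (Assembly.X 𝔹) base
      ; A = A 𝔹 ⊗ (A 𝔸 ⇒ A 𝕄)
      ; α = λ (b , _) r → α 𝔹 b (fst · r) × Witnesses b (snd · r)
      ; α-inh = λ (b , φ , wφ) → pair · realizer 𝔹 b · φ
                                , α-≡ 𝔹 (fst-eq _ _) (realizer-α 𝔹 b)
                                , subst (Witnesses b) (sym (snd-eq _ _)) wφ
      ; α-resp = λ b≃b′ _ (rb , w) → α-resp 𝔹 b≃b′ rb
                                   , λ a ra fa≃b′ → w a ra (≃-trans 𝔹 fa≃b′ (≃-sym 𝔹 b≃b′)) }

    incl : Hom obj 𝔹
    incl = record { fun = proj₁ ; fun-resp = λ b≃b′ → b≃b′ ; tracker = fst ; tracks = λ _ _ → proj₁ }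

    sub : Sub (Asm 𝒯) 𝔹
    sub = record { dom = obj ; arr = incl ; mono = injective⇒mono incl (λ b≃b′ → b≃b′) }

    pullback≤⇒≤∀ : (n : Sub (Asm 𝒯) 𝔹) → (f *) n ≤ m → n ≤ sub
    pullback≤⇒≤∀ n (h , mh≈π₂) = g , λ _ → ≃-refl 𝔹
      where
      ℕ = Sub.dom n
      n→ = Sub.arr n

      witnesses : ∀ y r → α ℕ y r → Witnesses (fun n→ y) (Λ (tracker h) · r)
      witnesses y r ry a ra fa≃ny ra-α =
          fun h z , mh≈π₂ z
        , α-≡ 𝕄 (Λ-eq _ r ra) (tracks h z _ (α-≡ ℕ (fst-eq _ _) ry , α-≡ 𝔸 (snd-eq _ _) ra-α))
        where z = y , a , ≃-sym 𝔹 fa≃ny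

      g : Hom ℕ obj
      g = record
        { fun      = λ y → fun n→ y , Λ (tracker h) · realizer ℕ y , witnesses y _ (realizer-α ℕ y)
        ; fun-resp = fun-resp n→
        ; tracker  = ⟨ tracker n→ , Λ (tracker h) ⟩
        ; tracks   = λ y r ry → α-≡ 𝔹 (fst-⟨,⟩ _ _ r) (tracks n→ y r ry)
                              , subst (Witnesses (fun n→ y)) (sym (snd-⟨,⟩ _ _ r)) (witnesses y r ry) }

    ≤∀⇒pullback≤ : (n : Sub (Asm 𝒯) 𝔹) → n ≤ sub → (f *) n ≤ m
    ≤∀⇒pullback≤ n (g , g≈n) = h , mh≈π₂
      where
      ℕ = Sub.dom n
      inj = Sub-injective m

      fibre : ∀ {y a} → 𝔹 ∋ fun (Sub.arr n) y ≃ fun f a → 𝔹 ∋ fun f a ≃ proj₁ (fun g y)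
      fibre ny≃fa = ≃-trans 𝔹 (≃-sym 𝔹 ny≃fa) (≃-sym 𝔹 (g≈n _))

      witness : (z : Car (Sub.dom ((f *) n))) → Σ (Car 𝕄) λ x → 𝔸 ∋ fun (Sub.arr m) x ≃ proj₁ (proj₂ z)
      witness (y , a , ny≃fa) =
        let (x , mx≃a , _) = proj₂ (proj₂ (fun g y)) a (realizer 𝔸 a) (fibre ny≃fa) (realizer-α 𝔸 a)
        in x , mx≃a

      mh≈π₂ : ∀ z → 𝔸 ∋ fun (Sub.arr m) (proj₁ (witness z)) ≃ proj₁ (proj₂ z)
      mh≈π₂ z = proj₂ (witness z)

      apply : El (A ℕ ⊗ A 𝔸 ⇒ A 𝕄)
      apply = s · B snd (B (tracker g) fst) · snd

      apply-eq : ∀ q → apply · q ≡ snd · (tracker g · (fst · q)) · (snd · q)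
      apply-eq q = trans (s-eq _ _ q) (cong (_· (snd · q)) (trans (B-eq _ _ q) (cong (snd ·_) (B-eq _ _ q))))

      h : Hom (Sub.dom ((f *) n)) 𝕄
      h = record
        { fun      = λ z → proj₁ (witness z)
        ; fun-resp = λ {z} {z′} (_ , a≃a′) → inj (≃-trans 𝔸 (mh≈π₂ z) (≃-trans 𝔸 a≃a′ (≃-sym 𝔸 (mh≈π₂ z′))))
        ; tracker  = apply
        ; tracks   = λ (y , a , ny≃fa) q (ry , ra) →
            let (x , mx≃a , rx) = proj₂ (tracks g y (fst · q) ry) a (snd · q) (fibre ny≃fa) ra
            in α-≡ 𝕄 (apply-eq q) (α-resp 𝕄 (inj (≃-trans 𝔸 mx≃a (≃-sym 𝔸 (mh≈π₂ (y , a , ny≃fa))))) rx) }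

  universals : HasUniversalsOver (Asm 𝒯) regular
  universals = record
    { ∀[_]  = Forall.sub
    ; ∀-adj = λ f m n → Forall.pullback≤⇒≤∀ f m n , Forall.≤∀⇒pullback≤ f m n }

mainTheorem8 : (𝒯 : TCA) → IsHeyting (Asm 𝒯)
mainTheorem8 𝒯 = record
  { regular    = regular
  ; coherent   = SubobjectOrder.coherent-from-universals (Asm 𝒯) regular universals join bottom
  ; universals = universals }
  where open Assemblies 𝒯
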